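{- Let $G$ be a finite simple graph with $G\notin\{K_1,\overline{K_2}\}$. Then $\chi_{md}(G)=2$ if and only if $G$ is bipartite with partition sets $X$ and $Y$ (a partition of $V(G)$ into two independent sets) such that at least one of the following holds: (i) $1\leq |X|\leq |Y|\leq 2$; (ii) $1\leq |X|\leq 2<|Y|$ and every $y\in Y$ satisfies $d(y)\geq 1$; (iii) $3\leq |X|\leq |Y|$, every $x\in X$ satisfies $d(x)\geq |Y|/2$, and every $y\in Y$ satisfies $d(y)\geq |X|/2$.
   Context: For a vertex $v$, $N[v]=N(v)\cup\{v\}$; $v$ dominates exactly the vertices of $N[v]$. A majority dominator coloring of $G$ is a proper vertex coloring such that for every vertex $v$ there is a color class $C$ with $|N[v]\cap C|\geq |C|/2$. $\chi_{md}(G)$ is the minimum number of color classes in a majority dominator coloring of $G$. $d(v)$ is the degree of $v$, and $\overline{K_2}$ is the edgeless graph on two vertices. -}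

module Defs where

open import Data.Nat using (ℕ; zero; suc; _+_; _*_; _≤_; _<_)
open import Data.Bool using (Bool; true; false; _∨_; if_then_else_)
open import Data.Fin using (Fin; zero; suc)
open import Data.Fin.Properties using (_≟_)
open import Data.Product using (Σ; ∃; _×_; _,_)
open import Data.Sum using (_⊎_)
open import Relation.Nullary using (¬_)
open import Relation.Nullary.Decidable using (⌊_⌋)
open import Relation.Binary.PropositionalEquality using (_≡_; _≢_)

record Graph : Set where
  field
    n      : ℕ
    adj    : Fin n → Fin n → Bool
    sym    : ∀ u v → adj u v ≡ adj v u
    irrefl : ∀ v → adj v v ≡ false
open Graph public

count : ∀ {m} → (Fin m → Bool) → ℕ
count {zero}  p = 0
count {suc m} p = (if p zero then 1 else 0) + count (λ i → p (suc i))

deg : (G : Graph) → Fin (n G) → ℕ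
deg G v = count (adj G v)

inN : (G : Graph) → Fin (n G) → Fin (n G) → Bool
inN G v u = ⌊ u ≟ v ⌋ ∨ adj G v u

inClass : (G : Graph) {k : ℕ} → (Fin (n G) → Fin k) → Fin k → Fin (n G) → Bool
inClass G c i u = ⌊ c u ≟ i ⌋

countNC : (G : Graph) {k : ℕ} → (Fin (n G) → Fin k) → Fin (n G) → Fin k → ℕ
countNC G c v i = count (λ u → inN G v u Data.Bool.∧ inClass G c i u)

Proper : (G : Graph) {k : ℕ} → (Fin (n G) → Fin k) → Set
Proper G c = ∀ u v → adj G u v ≡ true → c u ≢ c v

-- every one of the k colors is used, so there are exactly k color classes
AllUsed : (G : Graph) {k : ℕ} → (Fin (n G) → Fin k) → Set
AllUsed G {k} c = ∀ (i : Fin k) → ∃ λ u → c u ≡ i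

MajorityDominating : (G : Graph) {k : ℕ} → (Fin (n G) → Fin k) → Set
MajorityDominating G {k} c =
  ∀ v → Σ (Fin k) λ i → count (inClass G c i) ≤ 2 * countNC G c v i

HasMDC : Graph → ℕ → Set
HasMDC G k = Σ (Fin (n G) → Fin k) λ c →
  Proper G c × AllUsed G c × MajorityDominating G c

ChiMD≡ : Graph → ℕ → Set
ChiMD≡ G k = HasMDC G k × (∀ j → j < k → ¬ HasMDC G j)

IsK1 : Graph → Set
IsK1 G = n G ≡ 1

IsK2bar : Graph → Set
IsK2bar G = n G ≡ 2 × (∀ u v → adj G u v ≡ false)

-- bipartition: side u ≡ false means u ∈ X, true means u ∈ Y;
-- both X and Y are independent sets
IsBipartition : (G : Graph) → (Fin (n G) → Bool) → Set
IsBipartition G side = ∀ u v → adj G u v ≡ true → side u ≢ side v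

inX inY : (G : Graph) → (Fin (n G) → Bool) → Fin (n G) → Bool
inX G side u = if side u then false else true
inY G side u = side u

sizeX sizeY : (G : Graph) → (Fin (n G) → Bool) → ℕ
sizeX G side = count (inX G side)
sizeY G side = count (inY G side)

CondI : (G : Graph) → (Fin (n G) → Bool) → Set
CondI G s = 1 ≤ sizeX G s × sizeX G s ≤ sizeY G s × sizeY G s ≤ 2

CondII : (G : Graph) → (Fin (n G) → Bool) → Set
CondII G s = 1 ≤ sizeX G s × sizeX G s ≤ 2 × 2 < sizeY G s
  × (∀ y → s y ≡ true → 1 ≤ deg G y)

CondIII : (G : Graph) → (Fin (n G) → Bool) → Set
CondIII G s = 3 ≤ sizeX G s × sizeX G s ≤ sizeY G s
  × (∀ x → s x ≡ false → sizeY G s ≤ 2 * deg G x)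
  × (∀ y → s y ≡ true → sizeX G s ≤ 2 * deg G y)

-- In a proper colouring N[v] meets the colour class of v in v alone. With two
-- classes X and Y (a bipartition), N[v] meets the other class exactly in N(v),
-- so a vertex x ∈ X is majority dominated iff |X| ≤ 2 or |Y| ≤ 2 d(x), and
-- symmetrically on Y. Splitting according to whether |X| and |Y| exceed 2 turns
-- these inequalities into (i)-(iii). A single class would be all of V(G) and be
-- met by N[v] in v alone, forcing an edgeless graph on at most two vertices,
-- i.e. K₁ or the complement of K₂.

{-# OPTIONS --safe #-}
module Submission where

open import Defs hiding (sym)
open import Data.Bool using (Bool; true; false; not; _∧_; if_then_else_)
open import Data.Bool.Properties using (¬-not; not-injective)
open import Data.Fin using (Fin; zero; suc)
open import Data.Fin.Properties using (_≟_; suc-injective; 0≢1+n; 2↔Bool)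
open import Data.Nat using (ℕ; zero; suc; _+_; _≤_; _<_; _*_; z≤n; s≤s; _≤?_)
open import Data.Nat.Properties using (≤-trans; ≤-total; ≰⇒>; *-monoʳ-≤)
open import Data.Product using (Σ; _×_; _,_; ∃; proj₁)
open import Data.Sum using (_⊎_; inj₁; inj₂)
open import Data.Empty using (⊥-elim)
open import Function using (_∘_)
open import Function.Bundles using (_⇔_; mk⇔; Inverse; Equivalence)
import Function.Properties.Equivalence as ⇔
open import Relation.Nullary using (¬_; yes; no)
open import Relation.Nullary.Decidable using (⌊_⌋; dec-true; isYes≗does)
open import Relation.Binary.PropositionalEquality
  using (_≡_; _≢_; refl; sym; trans; cong; cong₂; subst; subst₂)

open Inverse 2↔Bool using ()
  renaming (to to toBool; from to fromBool; strictlyInverseʳ to fromBool-toBool)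
open Equivalence using (to; from)

count-cong : ∀ {m} {p q : Fin m → Bool} → (∀ u → p u ≡ q u) → count p ≡ count q
count-cong {zero}  p≗q = refl
count-cong {suc m} p≗q =
  cong₂ (λ b k → (if b then 1 else 0) + k) (p≗q zero) (count-cong (p≗q ∘ suc))

count-all : ∀ {m} {p : Fin m → Bool} → (∀ u → p u ≡ true) → count p ≡ m
count-all {zero}  all = refl
count-all {suc m} all rewrite all zero = cong suc (count-all (all ∘ suc))

count-none : ∀ {m} {p : Fin m → Bool} → (∀ u → p u ≡ false) → count p ≡ 0
count-none {zero}  none = refl
count-none {suc m} none rewrite none zero = count-none (none ∘ suc)

count-unique : ∀ {m} {p : Fin m → Bool} {v} →
               p v ≡ true → (∀ u → p u ≡ true → u ≡ v) → count p ≡ 1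
count-unique {v = zero} pv unique rewrite pv =
  cong suc (count-none λ u → ¬-not λ pu → 0≢1+n (sym (unique (suc u) pu)))
count-unique {p = p} {suc v} pv unique
  rewrite ¬-not {p zero} λ p0 → 0≢1+n (unique zero p0) =
  count-unique pv λ u pu → suc-injective (unique (suc u) pu)

witness⇒1≤count : ∀ {m} {p : Fin m → Bool} {u} → p u ≡ true → 1 ≤ count p
witness⇒1≤count {u = zero}  pu rewrite pu = s≤s z≤n
witness⇒1≤count {p = p} {suc u} pu with p zero
... | true  = s≤s z≤n
... | false = witness⇒1≤count {p = p ∘ suc} pu

1≤count⇒witness : ∀ {m} {p : Fin m → Bool} → 1 ≤ count p → ∃ λ u → p u ≡ true
1≤count⇒witness {suc m} {p} 1≤c with p zero in p0
... | true  = zero , p0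
... | false with 1≤count⇒witness 1≤c
...   | u , pu = suc u , pu

∧-true : ∀ {a b} → a ∧ b ≡ true → a ≡ true × b ≡ true
∧-true {true} {true} refl = refl , refl

≟-true⇒≡ : ∀ {k} {i j : Fin k} → ⌊ i ≟ j ⌋ ≡ true → i ≡ j
≟-true⇒≡ {i = i} {j} eq with i ≟ j
... | yes i≡j = i≡j

≡⇒≟-true : ∀ {k} {i j : Fin k} → i ≡ j → ⌊ i ≟ j ⌋ ≡ true
≡⇒≟-true {i = i} {j} i≡j = trans (isYes≗does (i ≟ j)) (dec-true (i ≟ j) i≡j)

fin1-unique : (i j : Fin 1) → i ≡ j
fin1-unique zero zero = refl

fromBool-injective : ∀ {a b} → fromBool a ≡ fromBool b → a ≡ b
fromBool-injective {false} {false} _ = refl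
fromBool-injective {true}  {true}  _ = refl

fin2-cases : ∀ b (i : Fin 2) → i ≡ fromBool b ⊎ i ≡ fromBool (not b)
fin2-cases false zero       = inj₁ refl
fin2-cases false (suc zero) = inj₂ refl
fin2-cases true  zero       = inj₂ refl
fin2-cases true  (suc zero) = inj₁ refl

-- own and other are the sizes of the colour class of a vertex and of the other class.
MajorityCondition : ℕ → ℕ → ℕ → Set
MajorityCondition own other d = own ≤ 2 ⊎ other ≤ 2 * d

MajorityCondition-resolve : ∀ {own other d} → ¬ own ≤ 2 →
                            MajorityCondition own other d → other ≤ 2 * d
MajorityCondition-resolve own≰2 (inj₁ own≤2) = ⊥-elim (own≰2 own≤2)
MajorityCondition-resolve own≰2 (inj₂ h)     = h

1≤m≤2*n⇒1≤n : ∀ {m n} → 1 ≤ m → m ≤ 2 * n → 1 ≤ n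
1≤m≤2*n⇒1≤n {n = zero}  1≤m m≤0 with ≤-trans 1≤m m≤0
... | ()
1≤m≤2*n⇒1≤n {n = suc _} _   _   = s≤s z≤n

module _ (G : Graph) where

  IsMDC : ∀ {k} → (Fin (n G) → Fin k) → Set
  IsMDC c = Proper G c × AllUsed G c × MajorityDominating G c

  inN-self : ∀ v → inN G v v ≡ true
  inN-self v rewrite ≡⇒≟-true (refl {x = v}) = refl

  inN-true : ∀ {v u} → inN G v u ≡ true → u ≡ v ⊎ adj G v u ≡ true
  inN-true {v} {u} eq with u ≟ v
  ... | yes u≡v = inj₁ u≡v
  ... | no  _   = inj₂ eq

  countNC-own : ∀ {k} {c : Fin (n G) → Fin k} → Proper G c → ∀ v → countNC G c v (c v) ≡ 1
  countNC-own {c = c} proper v = count-unique own unique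
    where
    own : inN G v v ∧ inClass G c (c v) v ≡ true
    own rewrite inN-self v = ≡⇒≟-true refl
    unique : ∀ u → inN G v u ∧ inClass G c (c v) u ≡ true → u ≡ v
    unique u eq with ∧-true eq
    ... | near , same with inN-true near
    ...   | inj₁ u≡v = u≡v
    ...   | inj₂ vu  = ⊥-elim (proper v u vu (sym (≟-true⇒≡ same)))

  IsMDC-cong : ∀ {k} {c c′ : Fin (n G) → Fin k} → (∀ u → c u ≡ c′ u) → IsMDC c → IsMDC c′
  IsMDC-cong {c = c} {c′} c≗c′ (proper , used , dominating) = proper′ , used′ , dominating′
    where
    proper′ : Proper G c′
    proper′ u v uv c′u≡c′v = proper u v uv (trans (c≗c′ u) (trans c′u≡c′v (sym (c≗c′ v))))
    used′ : AllUsed G c′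
    used′ i with used i
    ... | u , cu≡i = u , trans (sym (c≗c′ u)) cu≡i
    dominating′ : MajorityDominating G c′
    dominating′ v with dominating v
    ... | i , h = i , subst₂ (λ a b → a ≤ 2 * b) class≡ neighbours≡ h
      where
      class≡ : count (inClass G c i) ≡ count (inClass G c′ i)
      class≡ = count-cong λ u → cong (λ j → ⌊ j ≟ i ⌋) (c≗c′ u)
      neighbours≡ : countNC G c v i ≡ countNC G c′ v i
      neighbours≡ = count-cong λ u → cong (λ j → inN G v u ∧ ⌊ j ≟ i ⌋) (c≗c′ u)

  one-colour-order≤2 : {c : Fin (n G) → Fin 1} → IsMDC c → Fin (n G) → n G ≤ 2
  one-colour-order≤2 {c} (proper , _ , dominating) v with dominating v
  ... | i , h rewrite fin1-unique i (c v) | countNC-own proper v =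
    subst (_≤ 2) (count-all λ u → ≡⇒≟-true (fin1-unique (c u) (c v))) h

  one-colour-edgeless : {c : Fin (n G) → Fin 1} → IsMDC c → ∀ u v → adj G u v ≡ false
  one-colour-edgeless {c} (proper , _) u v =
    ¬-not λ uv → proper u v uv (fin1-unique (c u) (c v))

  fewer-colours-impossible : ¬ IsK1 G → ¬ IsK2bar G → Fin (n G) →
                             ∀ j → j < 2 → ¬ HasMDC G j
  fewer-colours-impossible _ _ v zero _ (c , _) with c v
  ... | ()
  fewer-colours-impossible ¬K1 ¬K2bar v (suc zero) _ (_ , mdc) =
    ¬K2bar (order≡2 (n G) (one-colour-order≤2 mdc v) v ¬K1 , one-colour-edgeless mdc)
    where
    order≡2 : ∀ m → m ≤ 2 → Fin m → m ≢ 1 → m ≡ 2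
    order≡2 (suc zero)          _              _ m≢1 = ⊥-elim (m≢1 refl)
    order≡2 (suc (suc zero))    _              _ _   = refl
    order≡2 (suc (suc (suc _))) (s≤s (s≤s ())) _ _
  fewer-colours-impossible _ _ _ (suc (suc _)) (s≤s (s≤s ()))

  chiMD≡2⇔hasMDC₂ : ¬ IsK1 G → ¬ IsK2bar G → ChiMD≡ G 2 ⇔ HasMDC G 2
  chiMD≡2⇔hasMDC₂ ¬K1 ¬K2bar = mk⇔ (λ (mdc , _) → mdc) λ mdc@(_ , _ , used , _) →
    mdc , fewer-colours-impossible ¬K1 ¬K2bar (proj₁ (used zero))

  colouring : (Fin (n G) → Bool) → Fin (n G) → Fin 2
  colouring s = fromBool ∘ s

  sizeSide : (Fin (n G) → Bool) → Bool → ℕ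
  sizeSide s false = sizeX G s
  sizeSide s true  = sizeY G s

  DegreeCondition : (Fin (n G) → Bool) → Set
  DegreeCondition s =
    (∀ x → s x ≡ false → MajorityCondition (sizeX G s) (sizeY G s) (deg G x)) ×
    (∀ y → s y ≡ true  → MajorityCondition (sizeY G s) (sizeX G s) (deg G y))

  MajorityBipartition : (Fin (n G) → Bool) → Set
  MajorityBipartition s =
    IsBipartition G s × 1 ≤ sizeX G s × 1 ≤ sizeY G s × DegreeCondition s

  module _ {s : Fin (n G) → Bool} where

    Dominated : Fin (n G) → Set
    Dominated v =
      Σ (Fin 2) λ i → count (inClass G (colouring s) i) ≤ 2 * countNC G (colouring s) v i

    proper⇔bipartition : Proper G (colouring s) ⇔ IsBipartition G s
    proper⇔bipartition = mk⇔
      (λ proper u v uv su≡sv → proper u v uv (cong fromBool su≡sv))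
      (λ bip u v uv cu≡cv → bip u v uv (fromBool-injective cu≡cv))

    classSize : ∀ b → count (inClass G (colouring s) (fromBool b)) ≡ sizeSide s b
    classSize false = count-cong λ u → inX≡ (s u)
      where inX≡ : ∀ a → ⌊ fromBool a ≟ zero ⌋ ≡ (if a then false else true)
            inX≡ false = refl
            inX≡ true  = refl
    classSize true = count-cong λ u → inY≡ (s u)
      where inY≡ : ∀ a → ⌊ fromBool a ≟ suc zero ⌋ ≡ a
            inY≡ false = refl
            inY≡ true  = refl

    allUsed⇔nonempty : AllUsed G (colouring s) ⇔ (1 ≤ sizeX G s × 1 ≤ sizeY G s)
    allUsed⇔nonempty = mk⇔
      (λ used → nonempty false (used zero) , nonempty true (used (suc zero)))
      (λ { (1≤X , _) zero → witness false 1≤X ; (_ , 1≤Y) (suc zero) → witness true 1≤Y })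
      where
      nonempty : ∀ b → (∃ λ u → colouring s u ≡ fromBool b) → 1 ≤ sizeSide s b
      nonempty b (u , cu≡b) = subst (1 ≤_) (classSize b)
        (witness⇒1≤count {p = inClass G (colouring s) (fromBool b)} (≡⇒≟-true cu≡b))
      witness : ∀ b → 1 ≤ sizeSide s b → ∃ λ u → colouring s u ≡ fromBool b
      witness b 1≤size with 1≤count⇒witness (subst (1 ≤_) (sym (classSize b)) 1≤size)
      ... | u , cu≡b = u , ≟-true⇒≡ cu≡b

    countNC-opposite : IsBipartition G s → ∀ v →
                       countNC G (colouring s) v (fromBool (not (s v))) ≡ deg G v
    countNC-opposite bip v = count-cong pointwise
      where
      pointwise : ∀ u → inN G v u ∧ inClass G (colouring s) (fromBool (not (s v))) u ≡ adj G v u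
      pointwise u with u ≟ v
      ... | yes refl rewrite irrefl G u with s u
      ...   | false = refl
      ...   | true  = refl
      pointwise u | no _ with adj G v u in vu
      ...   | false = refl
      ...   | true rewrite ¬-not (λ su≡sv → bip v u vu (sym su≡sv)) = ≡⇒≟-true refl

    dominated⇔majorityCondition : IsBipartition G s → ∀ {v b} → s v ≡ b →
      Dominated v ⇔ MajorityCondition (sizeSide s b) (sizeSide s (not b)) (deg G v)
    dominated⇔majorityCondition bip {v} refl = mk⇔ to′ from′
      where
      own : countNC G (colouring s) v (fromBool (s v)) ≡ 1
      own = countNC-own (from proper⇔bipartition bip) v
      opposite : countNC G (colouring s) v (fromBool (not (s v))) ≡ deg G v
      opposite = countNC-opposite bip v
      to′ : Dominated v → MajorityCondition (sizeSide s (s v)) (sizeSide s (not (s v))) (deg G v)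
      to′ (i , h) with fin2-cases (s v) i
      ... | inj₁ refl = inj₁ (subst₂ (λ a k → a ≤ 2 * k) (classSize (s v)) own h)
      ... | inj₂ refl = inj₂ (subst₂ (λ a k → a ≤ 2 * k) (classSize (not (s v))) opposite h)
      from′ : MajorityCondition (sizeSide s (s v)) (sizeSide s (not (s v))) (deg G v) → Dominated v
      from′ (inj₁ h) = fromBool (s v) ,
        subst₂ (λ a k → a ≤ 2 * k) (sym (classSize (s v))) (sym own) h
      from′ (inj₂ h) = fromBool (not (s v)) ,
        subst₂ (λ a k → a ≤ 2 * k) (sym (classSize (not (s v)))) (sym opposite) h

    majorityDominating⇔degreeCondition : IsBipartition G s →
      MajorityDominating G (colouring s) ⇔ DegreeCondition s
    majorityDominating⇔degreeCondition bip = mk⇔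
      (λ dominated → (λ x sx → to (dominated⇔majorityCondition bip sx) (dominated x)) ,
                     (λ y sy → to (dominated⇔majorityCondition bip sy) (dominated y)))
      (λ condition v → dominated v (s v) refl condition)
      where
      dominated : ∀ v b → s v ≡ b → DegreeCondition s → Dominated v
      dominated v false sv (onX , _) = from (dominated⇔majorityCondition bip sv) (onX v sv)
      dominated v true  sv (_ , onY) = from (dominated⇔majorityCondition bip sv) (onY v sv)

  hasMDC₂⇔majorityBipartition : HasMDC G 2 ⇔ Σ (Fin (n G) → Bool) MajorityBipartition
  hasMDC₂⇔majorityBipartition = mk⇔ to′ from′
    where
    to′ : HasMDC G 2 → Σ (Fin (n G) → Bool) MajorityBipartition
    to′ (c , mdc) with IsMDC-cong {c′ = colouring (toBool ∘ c)} (sym ∘ fromBool-toBool ∘ c) mdc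
    ... | proper , used , dominating =
      let bip = to proper⇔bipartition proper
          1≤X , 1≤Y = to allUsed⇔nonempty used
      in toBool ∘ c , bip , 1≤X , 1≤Y , to (majorityDominating⇔degreeCondition bip) dominating
    from′ : Σ (Fin (n G) → Bool) MajorityBipartition → HasMDC G 2
    from′ (s , bip , 1≤X , 1≤Y , condition) =
      colouring s , from proper⇔bipartition bip , from allUsed⇔nonempty (1≤X , 1≤Y) ,
      from (majorityDominating⇔degreeCondition bip) condition

  module _ {s : Fin (n G) → Bool} where

    sizeX-not : sizeX G (not ∘ s) ≡ sizeY G s
    sizeX-not = count-cong λ u → not-not (s u)
      where not-not : ∀ a → (if not a then false else true) ≡ a
            not-not false = refl
            not-not true  = refl

    sizeY-not : sizeY G (not ∘ s) ≡ sizeX G s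
    sizeY-not = count-cong λ u → not≡if (s u)
      where not≡if : ∀ a → not a ≡ (if a then false else true)
            not≡if false = refl
            not≡if true  = refl

    majorityBipartition-not : MajorityBipartition s → MajorityBipartition (not ∘ s)
    majorityBipartition-not (bip , 1≤X , 1≤Y , onX , onY) rewrite sizeX-not | sizeY-not =
      (λ u v uv nsu≡nsv → bip u v uv (not-injective nsu≡nsv)) , 1≤Y , 1≤X ,
      (λ x nsx → onY x (not-injective nsx)) , (λ y nsy → onX y (not-injective nsy))

    degreeCondition⇒conditions : 1 ≤ sizeX G s → sizeX G s ≤ sizeY G s → DegreeCondition s →
                                 CondI G s ⊎ CondII G s ⊎ CondIII G s
    degreeCondition⇒conditions 1≤X X≤Y (onX , onY) with sizeY G s ≤? 2 | sizeX G s ≤? 2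
    ... | yes Y≤2 | _        = inj₁ (1≤X , X≤Y , Y≤2)
    ... | no  Y≰2 | yes X≤2  = inj₂ (inj₁ (1≤X , X≤2 , ≰⇒> Y≰2 ,
      λ y sy → 1≤m≤2*n⇒1≤n 1≤X (MajorityCondition-resolve {d = deg G y} Y≰2 (onY y sy))))
    ... | no  Y≰2 | no  X≰2  = inj₂ (inj₂ (≰⇒> X≰2 , X≤Y ,
      (λ x sx → MajorityCondition-resolve {d = deg G x} X≰2 (onX x sx)) ,
      (λ y sy → MajorityCondition-resolve {d = deg G y} Y≰2 (onY y sy))))

    conditions⇒majorityBipartition : IsBipartition G s → CondI G s ⊎ CondII G s ⊎ CondIII G s →
                                     MajorityBipartition s
    conditions⇒majorityBipartition bip (inj₁ (1≤X , X≤Y , Y≤2)) =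
      bip , 1≤X , ≤-trans 1≤X X≤Y ,
      (λ _ _ → inj₁ (≤-trans X≤Y Y≤2)) , (λ _ _ → inj₁ Y≤2)
    conditions⇒majorityBipartition bip (inj₂ (inj₁ (1≤X , X≤2 , 2<Y , 1≤deg))) =
      bip , 1≤X , ≤-trans (s≤s z≤n) 2<Y ,
      (λ _ _ → inj₁ X≤2) , (λ y sy → inj₂ (≤-trans X≤2 (*-monoʳ-≤ 2 (1≤deg y sy))))
    conditions⇒majorityBipartition bip (inj₂ (inj₂ (3≤X , X≤Y , onX , onY))) =
      bip , ≤-trans (s≤s z≤n) 3≤X , ≤-trans (≤-trans (s≤s z≤n) 3≤X) X≤Y ,
      (λ x sx → inj₂ (onX x sx)) , (λ y sy → inj₂ (onY y sy))

  -- The conditions (i)-(iii) presuppose |X| ≤ |Y|, so the sides may have to be swapped.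
  majorityBipartition⇔conditions :
    Σ (Fin (n G) → Bool) MajorityBipartition ⇔
    Σ (Fin (n G) → Bool) λ s → IsBipartition G s × (CondI G s ⊎ CondII G s ⊎ CondIII G s)
  majorityBipartition⇔conditions = mk⇔ to′
    (λ (s , bip , conditions) → s , conditions⇒majorityBipartition bip conditions)
    where
    to′ : Σ (Fin (n G) → Bool) MajorityBipartition →
          Σ (Fin (n G) → Bool) λ s → IsBipartition G s × (CondI G s ⊎ CondII G s ⊎ CondIII G s)
    to′ (s , mb@(bip , 1≤X , _ , condition)) with ≤-total (sizeX G s) (sizeY G s)
    ... | inj₁ X≤Y = s , bip , degreeCondition⇒conditions 1≤X X≤Y condition
    ... | inj₂ Y≤X with majorityBipartition-not mb
    ...   | bip′ , 1≤X′ , _ , condition′ =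
      not ∘ s , bip′ ,
      degreeCondition⇒conditions 1≤X′ (subst₂ _≤_ (sym sizeX-not) (sym sizeY-not) Y≤X) condition′

proposition2p9 : (G : Graph) → ¬ IsK1 G → ¬ IsK2bar G →
    (ChiMD≡ G 2 ⇔ Σ (Fin (Graph.n G) → Bool) λ s →
      IsBipartition G s × (CondI G s ⊎ CondII G s ⊎ CondIII G s))
proposition2p9 G ¬K1 ¬K2bar =
  ⇔.trans (chiMD≡2⇔hasMDC₂ G ¬K1 ¬K2bar)
    (⇔.trans (hasMDC₂⇔majorityBipartition G) (majorityBipartition⇔conditions G))
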